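{- Let $\mathfrak A$ be a compact set of first-order $\Sigma$-structures and $\Gamma$ a finite set of HoCHCs not containing $\lambda$-abstractions. Then $\Gamma$ is $\mathfrak A$-satisfiable if and only if its first-order translation $\lfloor\Gamma\rfloor$ is $\mathfrak A$-satisfiable.
   Context: Types. Base type $\iota$. Argument types $\tau::=\iota\mid\rho$; relational types $\rho::=o\mid\tau\to\rho$; first-order types $\sigma_{FO}::=\iota\mid\iota\to o\mid\iota\to\sigma_{FO}$; types $\sigma::=\rho\mid\sigma_{FO}$. A fixed type environment $\Delta$ maps variables to argument types. Terms: $M::=x\mid c\mid\neg\mid\land\mid\lor\mid\exists_\tau\mid MM\mid\lambda x.M$, simply typed ($\lambda x.M$ only for bodies of relational type; $\exists_\tau:(\tau\to o)\to o$). A first-order $\Sigma$-formula uses only first-order-typed symbols, variables of type $\iota$, no $\lambda$. Fix a first-order signature $\Sigma$ over $\iota$ and $\Sigma'\supseteq\Sigma$ adding only relational-typed symbols. An atom is a $\Sigma'$-formula without logical symbols; a background atom is one that is a first-order $\Sigma$-formula; any other atom is a foreground atom. Goal clause $\neg A_1\lor\cdots\lor\neg A_n$ ($\bot$ if $n=0$); definite clause $G\lor R\,x_1\cdots x_n$ with $R\in\Sigma'\setminus\Sigma$, $x_i$ distinct variables; HoCHC: goal or definite clause, free variables universally quantified. Semantics: for a first-order $\Sigma$-structure $\mathcal A$, a $\Sigma'$-expansion $\mathcal B$ of $\mathcal A$ (standard semantics: $\iota$ is $\mathcal A[\![\iota]\!]$, $o$ is $\{0,1\}$, function types are all functions; $\exists_\tau$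 is maximum over the domain of $\tau$) agrees with $\mathcal A$ on $\Sigma$. A set $\Gamma$ of HoCHCs is $\mathfrak A$-satisfiable if for some $\mathcal A\in\mathfrak A$ some $\Sigma'$-expansion of $\mathcal A$ satisfies all clauses of $\Gamma$ (for all valuations). $\mathfrak A$ is compact if every $\mathfrak A$-unsatisfiable set of goal clauses consisting of background atoms has a finite $\mathfrak A$-unsatisfiable subset (such a set is $\mathfrak A$-satisfiable iff some $\mathcal A\in\mathfrak A$ satisfies all its clauses). Translation. Use a many-sorted first-order language with sorts $\iota$ and a new sort $\lfloor\rho\rfloor$ for each relational type $\rho$; set $\lfloor\iota\rfloor=\iota$ and $\lfloor\iota^n\to\iota\rfloor=\iota^n\to\iota$. Variables $x$ get sort $\lfloor\Delta(x)\rfloor$. The signature $\lfloor\Sigma'\rfloor$ consists of $\Sigma$, constants $c_R:\lfloor\rho\rfloor$ for $R:\rho\in\Sigma'\setminus\Sigma$, constants $c_\rho:\lfloor\rho\rfloor$ for each relational $\rho$, binary function symbols $\mathrm{app}_{\tau,\rho}:\lfloor\tau\to\rho\rfloor\times\lfloor\tau\rfloor\to\lfloor\rho\rfloor$ for each relational $\tau\to\rho$, and a unary predicate $H$ on sort $\lfloor o\rfloor$. For a $\Sigma'$-term $M$ without logical symbols and $\lambda$: $\lfloor x\rfloor'=x$; $\lfloor R\rfloor'=c_R$ for $R\in\Sigma'\setminus\Sigma$; $\lfloor c\,\overline N\rfloor'=c\,\overline N$ if $c\in\Sigma$; $\lfloor M\,\overline N\,N'\rfloor'=\mathrm{app}(\lfloor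 M\,\overline N\rfloor',\lfloor N'\rfloor')$ if the head $M$ is not in $\Sigma$. For an atom $A$: $\lfloor A\rfloor=A$ if $A=c\,\overline N$ with $c\in\Sigma$, otherwise $\lfloor A\rfloor=H(\lfloor A\rfloor')$; clauses are translated literalwise. For relational $\rho=\tau_1\to\cdots\to\tau_n\to o$, $\mathrm{Comp}_\rho=H(\mathrm{app}(\cdots\mathrm{app}(\mathrm{app}(c_\rho,x_1),x_2)\cdots,x_n))$ with distinct variables $x_i$ of sorts $\lfloor\tau_i\rfloor$. $\lfloor\Gamma\rfloor=\{\lfloor C\rfloor\mid C\in\Gamma\}\cup\{\mathrm{Comp}_\rho\mid$ a variable $x$ with $\Delta(x)=\rho$ relational occurs in $\Gamma\}$. $\lfloor\Gamma\rfloor$ is $\mathfrak A$-satisfiable if there are $\mathcal A\in\mathfrak A$ and a many-sorted first-order $\lfloor\Sigma'\rfloor$-structure whose sort $\iota$ and $\Sigma$-symbols are interpreted as in $\mathcal A$ (other sorts by arbitrary nonempty sets) satisfying every clause of $\lfloor\Gamma\rfloor$ with free variables universally quantified. -}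

module Defs where

open import Data.Nat using (ℕ; zero; suc)
open import Data.Bool using (Bool; true; false)
open import Data.Vec using (Vec; []; _∷_)
open import Data.List using (List; []; _∷_; map; _++_)
open import Data.List.Relation.Unary.Any using (Any)
open import Data.List.Relation.Unary.All using (All)
open import Data.List.Relation.Unary.Unique.Propositional using (Unique)
open import Data.List.Membership.Propositional using (_∈_)
open import Data.Product using (Σ; _×_)
open import Data.Sum using (_⊎_)
open import Data.Unit using (⊤)
open import Data.Empty using (⊥)
open import Relation.Nullary using (¬_)
open import Relation.Binary.PropositionalEquality using (_≡_)

mutual
  data ATy : Set where
    ι   : ATy
    rel : RTy → ATy

  data RTy : Set where
    o   : RTy
    _⇒_ : ATy → RTy → RTy

infixr 20 _⇒_

record Lang : Set₁ where
  field
    FSym   : Set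
    fArity : FSym → ℕ
    PSym   : Set
    pArity : PSym → ℕ          -- P : ι^(suc (pArity P)) → o
    RSym   : Set               -- the symbols of Σ' ∖ Σ
    rty    : RSym → RTy
    Var    : Set
    Δ      : Var → ATy

module _ (L : Lang) where
  open Lang L

  -- Σ'-terms without logical symbols and without λ.
  -- (Background symbols occur fully applied.)

  data Tm : ATy → Set where
    var : (x : Var) → Tm (Δ x)
    fn  : (f : FSym) → Vec (Tm ι) (fArity f) → Tm ι
    sym : (R : RSym) → Tm (rel (rty R))
    app : ∀ {τ ρ} → Tm (rel (τ ⇒ ρ)) → Tm τ → Tm (rel ρ)

  data Atom : Set where
    bg : (P : PSym) → Vec (Tm ι) (suc (pArity P)) → Atom
    fg : Tm (rel o) → Atom

  data IsBackground : Atom → Set where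
    bg : ∀ P ts → IsBackground (bg P ts)

  -- heads  R x₁ ⋯ xₙ  (variables listed in reverse order)
  data Head : {ρ : RTy} → Tm (rel ρ) → List Var → Set where
    sym : (R : RSym) → Head (sym R) []
    app : ∀ {ρ} (x : Var) {M : Tm (rel (Δ x ⇒ ρ))} {xs : List Var} →
          Head {Δ x ⇒ ρ} M xs → Head {ρ} (app M (var x)) (x ∷ xs)

  data Clause : Set where
    goal     : List Atom → Clause
    definite : (body : List Atom) (h : Tm (rel o)) (xs : List Var) →
               Head h xs → Unique xs → Clause

  data IsBackgroundGoal : Clause → Set where
    goal : ∀ {as} → All IsBackground as → IsBackgroundGoal (goal as)

  record Structure : Set₁ where
    field
      D    : Set
      elem : D
      fun  : (f : FSym) → Vec D (fArity f) → D
      pred : (P : PSym) → Vec D (suc (pArity P)) → Bool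

  module _ (𝒜 : Structure) where
    open Structure 𝒜

    mutual
      ⟦_⟧ᴬ : ATy → Set
      ⟦ ι ⟧ᴬ     = D
      ⟦ rel ρ ⟧ᴬ = ⟦ ρ ⟧ᴿ

      ⟦_⟧ᴿ : RTy → Set
      ⟦ o ⟧ᴿ     = Bool
      ⟦ τ ⇒ ρ ⟧ᴿ = ⟦ τ ⟧ᴬ → ⟦ ρ ⟧ᴿ

    Expansion : Set
    Expansion = (R : RSym) → ⟦ rel (rty R) ⟧ᴬ

    Valuation : Set
    Valuation = (x : Var) → ⟦ Δ x ⟧ᴬ

    module _ (I : Expansion) (v : Valuation) where
      mutual
        eval : ∀ {τ} → Tm τ → ⟦ τ ⟧ᴬ
        eval (var x)   = v x
        eval (fn f ts) = fun f (evals ts)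
        eval (sym R)   = I R
        eval (app M N) = eval M (eval N)

        evals : ∀ {n} → Vec (Tm ι) n → Vec D n
        evals []       = []
        evals (t ∷ ts) = eval t ∷ evals ts

      evalAtom : Atom → Bool
      evalAtom (bg P ts) = pred P (evals ts)
      evalAtom (fg M)    = eval M

      satClause : Clause → Set
      satClause (goal as) = Any (λ a → evalAtom a ≡ false) as
      satClause (definite body h _ _ _) =
        Any (λ a → evalAtom a ≡ false) body ⊎ eval h ≡ true

  Sat : (Structure → Set) → (Clause → Set) → Set₁
  Sat 𝔄 Γ = Σ Structure λ 𝒜 → 𝔄 𝒜 × Σ (Expansion 𝒜) λ I →
            ∀ C → Γ C → (v : Valuation 𝒜) → satClause 𝒜 I v C

  Compact : (Structure → Set) → Set₁
  Compact 𝔄 = (S : Clause → Set) → (∀ C → S C → IsBackgroundGoal C) →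
              ¬ Sat 𝔄 S →
              Σ (List Clause) λ F → (∀ C → C ∈ F → S C) × ¬ Sat 𝔄 (λ C → C ∈ F)

  mutual
    data OccTm (x : Var) : ∀ {τ} → Tm τ → Set where
      here : OccTm x (var x)
      fn   : ∀ {f ts} → OccTms x ts → OccTm x (fn f ts)
      appˡ : ∀ {τ ρ} {M : Tm (rel (τ ⇒ ρ))} {N : Tm τ} → OccTm x M → OccTm x (app M N)
      appʳ : ∀ {τ ρ} {M : Tm (rel (τ ⇒ ρ))} {N : Tm τ} → OccTm x N → OccTm x (app M N)

    data OccTms (x : Var) : ∀ {n} → Vec (Tm ι) n → Set where
      here  : ∀ {n t} {ts : Vec (Tm ι) n} → OccTm x t → OccTms x (t ∷ ts)
      there : ∀ {n t} {ts : Vec (Tm ι) n} → OccTms x ts → OccTms x (t ∷ ts)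

  OccAtom : Var → Atom → Set
  OccAtom x (bg P ts) = OccTms x ts
  OccAtom x (fg M)    = OccTm x M

  OccClause : Var → Clause → Set
  OccClause x (goal as) = Any (OccAtom x) as
  OccClause x (definite body h _ _ _) = Any (OccAtom x) body ⊎ OccTm x h

  data Sort : Set where
    sι : Sort
    ⌊_⌋ : RTy → Sort

  sortA : ATy → Sort
  sortA ι       = sι
  sortA (rel ρ) = ⌊ ρ ⌋

  data FVar : Sort → Set where
    src : (x : Var) → FVar (sortA (Δ x))
    aux : (s : Sort) → ℕ → FVar s

  data FTm : Sort → Set where
    var  : ∀ {s} → FVar s → FTm s
    fn   : (f : FSym) → Vec (FTm sι) (fArity f) → FTm sι
    cR   : (R : RSym) → FTm ⌊ rty R ⌋
    cρ   : (ρ : RTy) → FTm ⌊ ρ ⌋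
    appF : ∀ {τ ρ} → FTm ⌊ τ ⇒ ρ ⌋ → FTm (sortA τ) → FTm ⌊ ρ ⌋

  data FAtom : Set where
    pred : (P : PSym) → Vec (FTm sι) (suc (pArity P)) → FAtom
    H    : FTm ⌊ o ⌋ → FAtom

  data Literal : Set where
    pos neg : FAtom → Literal

  FClause : Set
  FClause = List Literal

  SortSem : Set → (RTy → Set) → Sort → Set
  SortSem D Car sι    = D
  SortSem D Car ⌊ ρ ⌋ = Car ρ

  record FOStructure (𝒜 : Structure) : Set₁ where
    open Structure 𝒜
    field
      Car  : RTy → Set
      c-R  : (R : RSym) → Car (rty R)
      c-ρ  : (ρ : RTy) → Car ρ
      appˢ : (τ : ATy) (ρ : RTy) → Car (τ ⇒ ρ) → SortSem D Car (sortA τ) → Car ρ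
      Hˢ   : Car o → Bool

  module _ {𝒜 : Structure} (B : FOStructure 𝒜) where
    open Structure 𝒜
    open FOStructure B

    FValuation : Set
    FValuation = ∀ {s} → FVar s → SortSem D Car s

    module _ (w : FValuation) where
      mutual
        feval : ∀ {s} → FTm s → SortSem D Car s
        feval (var y)   = w y
        feval (fn f ts) = fun f (fevals ts)
        feval (cR R)    = c-R R
        feval (cρ ρ)    = c-ρ ρ
        feval (appF {τ} {ρ} M N) = appˢ τ ρ (feval M) (feval N)

        fevals : ∀ {n} → Vec (FTm sι) n → Vec D n
        fevals []       = []
        fevals (t ∷ ts) = feval t ∷ fevals ts

      fevalAtom : FAtom → Bool
      fevalAtom (pred P ts) = Structure.pred 𝒜 P (fevals ts)
      fevalAtom (H t)       = Hˢ (feval t)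

      litTrue : Literal → Set
      litTrue (pos a) = fevalAtom a ≡ true
      litTrue (neg a) = fevalAtom a ≡ false

      fsatClause : FClause → Set
      fsatClause C = Any litTrue C

  FOSat : (Structure → Set) → (FClause → Set) → Set₁
  FOSat 𝔄 T = Σ Structure λ 𝒜 → 𝔄 𝒜 × Σ (FOStructure 𝒜) λ B →
              ∀ C → T C → (w : FValuation B) → fsatClause B w C

  mutual
    ⌊_⌋′ : ∀ {τ} → Tm τ → FTm (sortA τ)
    ⌊ var x ⌋′   = var (src x)
    ⌊ fn f ts ⌋′ = fn f ⌊ ts ⌋′s
    ⌊ sym R ⌋′   = cR R
    ⌊ app M N ⌋′ = appF ⌊ M ⌋′ ⌊ N ⌋′

    ⌊_⌋′s : ∀ {n} → Vec (Tm ι) n → Vec (FTm sι) n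
    ⌊ [] ⌋′s     = []
    ⌊ t ∷ ts ⌋′s = ⌊ t ⌋′ ∷ ⌊ ts ⌋′s

  ⌊_⌋ᵃ : Atom → FAtom
  ⌊ bg P ts ⌋ᵃ = pred P ⌊ ts ⌋′s
  ⌊ fg M ⌋ᵃ    = H ⌊ M ⌋′

  ⌊_⌋ᶜ : Clause → FClause
  ⌊ goal as ⌋ᶜ = map (λ a → neg ⌊ a ⌋ᵃ) as
  ⌊ definite body h _ _ _ ⌋ᶜ = map (λ a → neg ⌊ a ⌋ᵃ) body ++ (pos (H ⌊ h ⌋′) ∷ [])

  compTm : (ρ : RTy) → FTm ⌊ ρ ⌋ → ℕ → FTm ⌊ o ⌋
  compTm o       t i = t
  compTm (τ ⇒ ρ) t i = compTm ρ (appF t (var (aux (sortA τ) i))) (suc i)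

  Comp : RTy → FClause
  Comp ρ = pos (H (compTm ρ (cρ ρ) 0)) ∷ []

  ⌊_⌋ᴳ : List Clause → FClause → Set
  ⌊ Γ ⌋ᴳ D = (Σ Clause λ C → C ∈ Γ × D ≡ ⌊ C ⌋ᶜ)
          ⊎ (Σ Var λ x → Σ RTy λ ρ →
               Δ x ≡ rel ρ × (Σ Clause λ C → C ∈ Γ × OccClause x C) × D ≡ Comp ρ)

{-# OPTIONS --safe #-}
module Submission where

-- A standard model yields a first-order one: read ⌊ρ⌋ as the full function
-- space, app as application, H as the identity and c_ρ as the everywhere
-- true relation.
--
-- Conversely, relate a standard value f of type ρ to an element e of sort
-- ⌊ρ⌋ when every true instance of f, along related arguments, is an
-- instance of e that H makes true (a logical relation), and interpret R as
-- the largest standard relation related to c_R.  Atoms without negation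
-- are preserved along this relation, so true bodies stay true; a head
-- R x₁ ⋯ xₙ is true because its instances arise from first-order
-- valuations of the xᵢ, which can be chosen independently since the xᵢ are
-- distinct; a relational variable outside the head is sent to c_ρ, which
-- Comp_ρ makes the top element of its sort.
--
-- Compactness of 𝔄 is used only to reason classically.

open import Axiom.DoubleNegationElimination using (DoubleNegationElimination; dne⇒em)
open import Axiom.ExcludedMiddle using (ExcludedMiddle)
open import Data.Bool using (Bool; true; false)
open import Data.Empty using (⊥-elim)
open import Data.List using (List; []; _∷_; map)
open import Data.List.Membership.Propositional using (_∈_)
import Data.List.Relation.Unary.All as All
open import Data.List.Relation.Unary.AllPairs using (_∷_)
open import Data.List.Relation.Unary.Any using (Any; here; there)
import Data.List.Relation.Unary.Any.Properties as Any
open import Data.List.Relation.Unary.Unique.Propositional using (Unique)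
open import Data.Nat using (ℕ; suc; _≤_)
open import Data.Nat.Properties using (≤-refl; <⇒≤; <⇒≢)
open import Data.Product using (Σ; _×_; _,_; proj₁)
open import Data.Sum using (inj₁; inj₂)
open import Data.Unit using (⊤; tt)
open import Data.Vec using (Vec; []; _∷_)
open import Defs
open import Function.Bundles using (_⇔_; mk⇔)
open import Level using (0ℓ)
open import Relation.Binary.PropositionalEquality
  using (_≡_; _≢_; refl; trans; cong; cong₂; subst; subst₂)
import Relation.Binary.PropositionalEquality as ≡
open import Relation.Nullary using (¬_; yes; no; does)
open import Relation.Nullary.Decidable using (dec-true)

module _ (L : Lang) where
  open Lang L

  module _ (𝒜 : Structure L) where
    open Structure 𝒜 using (elem)

    ⊤ᴿ : (ρ : RTy) → ⟦_⟧ᴿ L 𝒜 ρ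
    ⊤ᴿ o       = true
    ⊤ᴿ (τ ⇒ ρ) = λ _ → ⊤ᴿ ρ

    inhabitant : (τ : ATy) → ⟦_⟧ᴬ L 𝒜 τ
    inhabitant ι       = elem
    inhabitant (rel ρ) = ⊤ᴿ ρ

  -- The set {⊥ | Q} is unsatisfiable when ¬ ¬ Q; a finite unsatisfiable
  -- subset of it cannot be empty, so it contains a witness of Q.
  compact⇒dne : {𝔄 : Structure L → Set} → Compact L 𝔄 →
                (𝒜 : Structure L) → 𝔄 𝒜 → DoubleNegationElimination 0ℓ
  compact⇒dne {𝔄} compact 𝒜 𝒜∈𝔄 {Q} ¬¬q =
    witness (compact Falsum (λ { _ (_ , refl) → goal All.[] }) unsat)
    where
      Falsum : Clause L → Set
      Falsum C = Q × C ≡ goal []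

      unsat : ¬ Sat L 𝔄 Falsum
      unsat (𝒜′ , _ , _ , sat) =
        ¬¬q λ q → Any.¬Any[] (sat (goal []) (q , refl) (λ x → inhabitant 𝒜′ (Δ x)))

      witness : Σ (List (Clause L)) (λ F → (∀ C → C ∈ F → Falsum C) × ¬ Sat L 𝔄 (_∈ F)) → Q
      witness ([] , _ , ¬sat) = ⊥-elim (¬sat (𝒜 , 𝒜∈𝔄 , (λ R → ⊤ᴿ 𝒜 (rty R)) , λ _ ()))
      witness (C ∷ _ , F⊆ , _) = proj₁ (F⊆ C (here refl))

  infix 4 _≐_

  _≐_ : ∀ {s s′} → FVar L s → FVar L s′ → Set
  _≐_ {s} {s′} y y′ = _≡_ {A = Σ (Sort L) (FVar L)} (s , y) (s′ , y′)

  src-injective : ∀ {x y} → src x ≐ src y → x ≡ y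
  src-injective refl = refl

  aux-injective : ∀ {s s′ i j} → aux s i ≐ aux s′ j → i ≡ j
  aux-injective refl = refl

  module Standard⇒FO (𝒜 : Structure L) (I : Expansion L 𝒜) where
    open Structure 𝒜 using (D; fun)

    fromSort : (τ : ATy) → SortSem L D (⟦_⟧ᴿ L 𝒜) (sortA L τ) → ⟦_⟧ᴬ L 𝒜 τ
    fromSort ι       a = a
    fromSort (rel ρ) a = a

    ℬ : FOStructure L 𝒜
    ℬ = record
      { Car  = ⟦_⟧ᴿ L 𝒜
      ; c-R  = I
      ; c-ρ  = ⊤ᴿ 𝒜
      ; appˢ = λ τ ρ f a → f (fromSort τ a)
      ; Hˢ   = λ b → b
      }

    module _ (w : FValuation L ℬ) where
      v : Valuation L 𝒜
      v x = fromSort (Δ x) (w (src x))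

      mutual
        feval-⌊⌋′ : ∀ {τ} (t : Tm L τ) → fromSort τ (feval L ℬ w (⌊_⌋′ L t)) ≡ eval L 𝒜 I v t
        feval-⌊⌋′ (var x)   = refl
        feval-⌊⌋′ (fn f ts) = cong (fun f) (fevals-⌊⌋′s ts)
        feval-⌊⌋′ (sym R)   = refl
        feval-⌊⌋′ (app M N) = cong₂ (λ f a → f a) (feval-⌊⌋′ M) (feval-⌊⌋′ N)

        fevals-⌊⌋′s : ∀ {n} (ts : Vec (Tm L ι) n) → fevals L ℬ w (⌊_⌋′s L ts) ≡ evals L 𝒜 I v ts
        fevals-⌊⌋′s []       = refl
        fevals-⌊⌋′s (t ∷ ts) = cong₂ _∷_ (feval-⌊⌋′ t) (fevals-⌊⌋′s ts)

      fevalAtom-⌊⌋ᵃ : (a : Atom L) → fevalAtom L ℬ w (⌊_⌋ᵃ L a) ≡ evalAtom L 𝒜 I v a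
      fevalAtom-⌊⌋ᵃ (bg P ts) = cong (Structure.pred 𝒜 P) (fevals-⌊⌋′s ts)
      fevalAtom-⌊⌋ᵃ (fg M)    = feval-⌊⌋′ M

      negated-⌊⌋ᵃ : (as : List (Atom L)) → Any (λ a → evalAtom L 𝒜 I v a ≡ false) as →
                    Any (litTrue L ℬ w) (map (λ a → neg (⌊_⌋ᵃ L a)) as)
      negated-⌊⌋ᵃ (a ∷ as) (here p)  = here (trans (fevalAtom-⌊⌋ᵃ a) p)
      negated-⌊⌋ᵃ (a ∷ as) (there p) = there (negated-⌊⌋ᵃ as p)

      fsat-⌊⌋ᶜ : (C : Clause L) → satClause L 𝒜 I v C → fsatClause L ℬ w (⌊_⌋ᶜ L C)
      fsat-⌊⌋ᶜ (goal as) s = negated-⌊⌋ᵃ as s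
      fsat-⌊⌋ᶜ (definite body h _ _ _) (inj₁ p) = Any.++⁺ˡ (negated-⌊⌋ᵃ body p)
      fsat-⌊⌋ᶜ (definite body h _ _ _) (inj₂ p) =
        Any.++⁺ʳ (map (λ a → neg (⌊_⌋ᵃ L a)) body) (here (trans (feval-⌊⌋′ h) p))

      compTm-true : ∀ ρ (t : FTm L ⌊ ρ ⌋) i → feval L ℬ w t ≡ ⊤ᴿ 𝒜 ρ →
                    feval L ℬ w (compTm L ρ t i) ≡ true
      compTm-true o       t i t≡⊤ = t≡⊤
      compTm-true (τ ⇒ ρ) t i t≡⊤ =
        compTm-true ρ _ (suc i) (cong (λ f → f (fromSort τ (w (aux (sortA L τ) i)))) t≡⊤)

  standard⇒fo : {𝔄 : Structure L → Set} (Γ : List (Clause L)) →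
                Sat L 𝔄 (_∈ Γ) → FOSat L 𝔄 (⌊_⌋ᴳ L Γ)
  standard⇒fo Γ (𝒜 , 𝒜∈𝔄 , I , sat) = 𝒜 , 𝒜∈𝔄 , ℬ , fsat
    where
      open Standard⇒FO 𝒜 I

      fsat : ∀ C → ⌊_⌋ᴳ L Γ C → (w : FValuation L ℬ) → fsatClause L ℬ w C
      fsat _ (inj₁ (C , C∈Γ , refl)) w = fsat-⌊⌋ᶜ w C (sat C C∈Γ (v w))
      fsat _ (inj₂ (_ , ρ , _ , _ , refl)) w = here (compTm-true w ρ (cρ ρ) 0 refl)

  module FO⇒Standard (𝒜 : Structure L) (ℬ : FOStructure L 𝒜) (em : ExcludedMiddle 0ℓ) where
    open Structure 𝒜 using (D; elem; fun)
    open FOStructure ℬ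

    Sem : Sort L → Set
    Sem = SortSem L D Car

    FV : Set
    FV = FValuation L ℬ

    mutual
      Belowᴬ : (τ : ATy) → ⟦_⟧ᴬ L 𝒜 τ → Sem (sortA L τ) → Set
      Belowᴬ ι       d d′ = d ≡ d′
      Belowᴬ (rel ρ) f e  = Below ρ f e

      Below : (ρ : RTy) → ⟦_⟧ᴿ L 𝒜 ρ → Car ρ → Set
      Below o       b e = b ≡ true → Hˢ e ≡ true
      Below (τ ⇒ ρ) f e = ∀ g g′ → Belowᴬ τ g g′ → Below ρ (f g) (appˢ τ ρ e g′)

    Full : (ρ : RTy) → Car ρ → Set
    Full o       e = Hˢ e ≡ true
    Full (τ ⇒ ρ) e = ∀ g′ → Full ρ (appˢ τ ρ e g′)

    full⇒below : ∀ ρ {e} f → Full ρ e → Below ρ f e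
    full⇒below o       f full _      = full
    full⇒below (τ ⇒ ρ) f full g g′ _ = full⇒below ρ (f g) (full g′)

    meet : (ρ : RTy) → (Car ρ → Set) → ⟦_⟧ᴿ L 𝒜 ρ
    meet o       P = does (em {∀ e → P e → Hˢ e ≡ true})
    meet (τ ⇒ ρ) P = λ g → meet ρ λ e′ →
      Σ (Car (τ ⇒ ρ)) λ e → P e × Σ (Sem (sortA L τ)) λ g′ → Belowᴬ τ g g′ × e′ ≡ appˢ τ ρ e g′

    meet-below : ∀ ρ P {e} → P e → Below ρ (meet ρ P) e
    meet-below o       P {e} pe with em {∀ e → P e → Hˢ e ≡ true}
    ... | yes all-true = λ _ → all-true e pe
    ... | no _         = λ ()
    meet-below (τ ⇒ ρ) P {e} pe g g′ g≼g′ = meet-below ρ _ (e , pe , g′ , g≼g′ , refl)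

    J : Expansion L 𝒜
    J R = meet (rty R) (_≡ c-R R)

    inhabitantˢ : (s : Sort L) → Sem s
    inhabitantˢ sι    = elem
    inhabitantˢ ⌊ ρ ⌋ = c-ρ ρ

    w₀ : FV
    w₀ {s} _ = inhabitantˢ s

    _[_≔_] : FV → ∀ {s} → FVar L s → Sem s → FV
    (w [ y ≔ a ]) y′ with em {y′ ≐ y}
    ... | yes refl = a
    ... | no _     = w y′

    update-same : ∀ (w : FV) {s} (y : FVar L s) a → (w [ y ≔ a ]) y ≡ a
    update-same w y a with em {y ≐ y}
    ... | yes refl = refl
    ... | no y≢y   = ⊥-elim (y≢y refl)

    update-other : ∀ (w : FV) {s} (y : FVar L s) a {s′} (y′ : FVar L s′) →
                   ¬ y′ ≐ y → (w [ y ≔ a ]) y′ ≡ w y′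
    update-other w y a y′ y′≢y with em {y′ ≐ y}
    ... | yes y′≡y = ⊥-elim (y′≢y y′≡y)
    ... | no _     = refl

    Avoids : ℕ → ∀ {s} → FTm L s → Set
    Avoids i t = ∀ (w : FV) {s} j (a : Sem s) → i ≤ j →
                 feval L ℬ (w [ aux s j ≔ a ]) t ≡ feval L ℬ w t

    appF-avoids : ∀ {τ ρ} i (t : FTm L ⌊ τ ⇒ ρ ⌋) → Avoids i t →
                  Avoids (suc i) (appF t (var (aux (sortA L τ) i)))
    appF-avoids {τ} {ρ} i t avoids w j a i<j =
      cong₂ (appˢ τ ρ) (avoids w j a (<⇒≤ i<j))
        (update-other w (aux _ j) a (aux _ i) λ eq → <⇒≢ i<j (aux-injective eq))

    compTm-full : ∀ ρ (t : FTm L ⌊ ρ ⌋) i → Avoids i t →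
                  (∀ (w : FV) → Hˢ (feval L ℬ w (compTm L ρ t i)) ≡ true) →
                  ∀ (w : FV) → Full ρ (feval L ℬ w t)
    compTm-full o       t i _      true-everywhere w = true-everywhere w
    compTm-full (τ ⇒ ρ) t i avoids true-everywhere w g′ =
      subst₂ (λ e a → Full ρ (appˢ τ ρ e a)) (avoids w i g′ ≤-refl) (update-same w (aux _ i) g′)
        (compTm-full ρ _ (suc i) (appF-avoids i t avoids) true-everywhere (w [ aux _ i ≔ g′ ]))

    c-ρ-full : ∀ ρ → (∀ (w : FV) → fsatClause L ℬ w (Comp L ρ)) → Full ρ (c-ρ ρ)
    c-ρ-full ρ Comp-sat = compTm-full ρ (cρ ρ) 0 (λ _ _ _ _ → refl) H-true w₀
      where
        H-true : ∀ (w : FV) → Hˢ (feval L ℬ w (compTm L ρ (cρ ρ) 0)) ≡ true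
        H-true w with Comp-sat w
        ... | here p = p

    default : (τ : ATy) → ⟦_⟧ᴬ L 𝒜 τ → Sem (sortA L τ)
    default ι       d = d
    default (rel ρ) _ = c-ρ ρ

    FullDefault : ATy → Set
    FullDefault ι       = ⊤
    FullDefault (rel ρ) = Full ρ (c-ρ ρ)

    below-default : ∀ τ g → FullDefault τ → Belowᴬ τ g (default τ g)
    below-default ι       g _    = refl
    below-default (rel ρ) g full = full⇒below ρ g full

    BelowOn : Valuation L 𝒜 → FV → (Var → Set) → Set
    BelowOn v w S = ∀ y → S y → Belowᴬ (Δ y) (v y) (w (src y))

    glue : List Var → FV → Valuation L 𝒜 → FV
    glue xs w v (src y) with em {y ∈ xs}
    ... | yes _ = w (src y)
    ... | no _  = default (Δ y) (v y)
    glue xs w v (aux s n) = w (aux s n)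

    glue-∈ : ∀ {xs} (w : FV) v {y} → y ∈ xs → glue xs w v (src y) ≡ w (src y)
    glue-∈ {xs} w v {y} y∈xs with em {y ∈ xs}
    ... | yes _  = refl
    ... | no y∉xs = ⊥-elim (y∉xs y∈xs)

    glue-below : ∀ {xs} {w : FV} v → BelowOn v w (_∈ xs) →
                 BelowOn v (glue xs w v) (λ y → FullDefault (Δ y))
    glue-below {xs} v v≼w y full with em {y ∈ xs}
    ... | yes y∈xs = v≼w y y∈xs
    ... | no _     = below-default (Δ y) (v y) full

    mutual
      feval-⌊⌋′-local : ∀ {τ} (t : Tm L τ) {w w′ : FV} →
                        (∀ y → OccTm L y t → w (src y) ≡ w′ (src y)) →
                        feval L ℬ w (⌊_⌋′ L t) ≡ feval L ℬ w′ (⌊_⌋′ L t)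
      feval-⌊⌋′-local (var x)   w≡w′ = w≡w′ x here
      feval-⌊⌋′-local (fn f ts) w≡w′ = cong (fun f) (fevals-⌊⌋′s-local ts λ y occ → w≡w′ y (fn occ))
      feval-⌊⌋′-local (sym R)   w≡w′ = refl
      feval-⌊⌋′-local (app {τ} {ρ} M N) w≡w′ =
        cong₂ (appˢ τ ρ) (feval-⌊⌋′-local M λ y occ → w≡w′ y (appˡ occ))
                         (feval-⌊⌋′-local N λ y occ → w≡w′ y (appʳ occ))

      fevals-⌊⌋′s-local : ∀ {n} (ts : Vec (Tm L ι) n) {w w′ : FV} →
                          (∀ y → OccTms L y ts → w (src y) ≡ w′ (src y)) →
                          fevals L ℬ w (⌊_⌋′s L ts) ≡ fevals L ℬ w′ (⌊_⌋′s L ts)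
      fevals-⌊⌋′s-local []       w≡w′ = refl
      fevals-⌊⌋′s-local (t ∷ ts) w≡w′ =
        cong₂ _∷_ (feval-⌊⌋′-local t λ y occ → w≡w′ y (here occ))
                  (fevals-⌊⌋′s-local ts λ y occ → w≡w′ y (there occ))

    head-occurs : ∀ {ρ} {M : Tm L (rel ρ)} {xs} → Head L M xs → ∀ {y} → OccTm L y M → y ∈ xs
    head-occurs (app x hd) (appˡ occ)  = there (head-occurs hd occ)
    head-occurs (app x hd) (appʳ here) = here refl

    contraposeᵇ : ∀ {b c : Bool} → (b ≡ true → c ≡ true) → c ≡ false → b ≡ false
    contraposeᵇ {false} _ _ = refl
    contraposeᵇ {true}  b⇒c c≡false with () ← trans (≡.sym (b⇒c refl)) c≡false

    module _ (v : Valuation L 𝒜) where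
      module _ (w : FV) where
        mutual
          eval-below : ∀ {τ} (t : Tm L τ) → BelowOn v w (λ y → OccTm L y t) →
                       Belowᴬ τ (eval L 𝒜 J v t) (feval L ℬ w (⌊_⌋′ L t))
          eval-below (var x)   v≼w = v≼w x here
          eval-below (fn f ts) v≼w = cong (fun f) (evals-≡ ts λ y occ → v≼w y (fn occ))
          eval-below (sym R)   v≼w = meet-below (rty R) _ refl
          eval-below (app M N) v≼w =
            eval-below M (λ y occ → v≼w y (appˡ occ)) _ _ (eval-below N λ y occ → v≼w y (appʳ occ))

          evals-≡ : ∀ {n} (ts : Vec (Tm L ι) n) → BelowOn v w (λ y → OccTms L y ts) →
                    evals L 𝒜 J v ts ≡ fevals L ℬ w (⌊_⌋′s L ts)
          evals-≡ []       v≼w = refl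
          evals-≡ (t ∷ ts) v≼w = cong₂ _∷_ (eval-below t λ y occ → v≼w y (here occ))
                                           (evals-≡ ts λ y occ → v≼w y (there occ))

        evalAtom-below : ∀ a → BelowOn v w (λ y → OccAtom L y a) →
                         evalAtom L 𝒜 J v a ≡ true → fevalAtom L ℬ w (⌊_⌋ᵃ L a) ≡ true
        evalAtom-below (bg P ts) v≼w = subst (λ ds → Structure.pred 𝒜 P ds ≡ true) (evals-≡ ts v≼w)
        evalAtom-below (fg M)    v≼w = eval-below M v≼w

        false-atoms : ∀ as → BelowOn v w (λ y → Any (OccAtom L y) as) →
                      Any (λ a → fevalAtom L ℬ w (⌊_⌋ᵃ L a) ≡ false) as →
                      Any (λ a → evalAtom L 𝒜 J v a ≡ false) as
        false-atoms (a ∷ as) v≼w (here p)  =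
          here (contraposeᵇ (evalAtom-below a (λ y occ → v≼w y (here occ))) p)
        false-atoms (a ∷ as) v≼w (there p) = there (false-atoms as (λ y occ → v≼w y (there occ)) p)

      Image : ∀ {ρ} → Tm L (rel ρ) → List Var → Car ρ → Set
      Image M xs e = Σ FV λ w → BelowOn v w (_∈ xs) × e ≡ feval L ℬ w (⌊_⌋′ L M)

      image-app : ∀ {ρ x xs} {M : Tm L (rel (Δ x ⇒ ρ))} → Head L M xs → All.All (x ≢_) xs →
                  ∀ {e g′} → Image M xs e → Belowᴬ (Δ x) (v x) g′ →
                  Image (app M (var x)) (x ∷ xs) (appˢ (Δ x) ρ e g′)
      image-app {ρ} {x} {xs} {M} hd x∉xs {g′ = g′} (w , v≼w , refl) v≼g′ = w′ , v≼w′ , app≡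
        where
          w′ : FV
          w′ = w [ src x ≔ g′ ]

          w′-on-xs : ∀ {y} → y ∈ xs → w′ (src y) ≡ w (src y)
          w′-on-xs y∈xs =
            update-other w (src x) g′ (src _)
              λ y≐x → All.lookup x∉xs y∈xs (≡.sym (src-injective y≐x))

          v≼w′ : BelowOn v w′ (_∈ x ∷ xs)
          v≼w′ y (here refl)  = subst (Belowᴬ (Δ x) (v x)) (≡.sym (update-same w (src x) g′)) v≼g′
          v≼w′ y (there y∈xs) = subst (Belowᴬ (Δ y) (v y)) (≡.sym (w′-on-xs y∈xs)) (v≼w y y∈xs)

          app≡ : appˢ (Δ x) ρ (feval L ℬ w (⌊_⌋′ L M)) g′ ≡
                 appˢ (Δ x) ρ (feval L ℬ w′ (⌊_⌋′ L M)) (w′ (src x))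
          app≡ = cong₂ (appˢ (Δ x) ρ)
                   (feval-⌊⌋′-local M λ y occ → ≡.sym (w′-on-xs (head-occurs hd occ)))
                   (≡.sym (update-same w (src x) g′))

      head-meet : ∀ {ρ} {M : Tm L (rel ρ)} {xs} → Head L M xs → Unique xs →
                  Σ (Car ρ → Set) λ P → eval L 𝒜 J v M ≡ meet ρ P × (∀ {e} → P e → Image M xs e)
      head-meet (sym R) _ = _ , refl , λ { refl → w₀ , (λ _ ()) , refl }
      head-meet (app x hd) (x∉xs ∷ unique) with head-meet hd unique
      ... | P , eval≡meet , P⊆image =
        _ , cong (λ f → f (v x)) eval≡meet ,
        λ { (_ , pe , _ , v≼g′ , refl) → image-app hd x∉xs (P⊆image pe) v≼g′ }

    module _ (Γ : List (Clause L))
             (⌊Γ⌋-sat : ∀ C → ⌊_⌋ᴳ L Γ C → (w : FV) → fsatClause L ℬ w C) where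
      occurs⇒full-default : ∀ {C y} → C ∈ Γ → OccClause L y C → FullDefault (Δ y)
      occurs⇒full-default {C} {y} C∈Γ occ with Δ y in Δy≡
      ... | ι     = tt
      ... | rel ρ = c-ρ-full ρ (⌊Γ⌋-sat _ (inj₂ (y , ρ , Δy≡ , (C , C∈Γ , occ) , refl)))

      module _ (v : Valuation L 𝒜) where
        below-glue : ∀ {C} xs {w : FV} → C ∈ Γ → BelowOn v w (_∈ xs) →
                     BelowOn v (glue xs w v) (λ y → OccClause L y C)
        below-glue xs C∈Γ v≼w y occ = glue-below v v≼w y (occurs⇒full-default C∈Γ occ)

        head-true : ∀ {body h xs hd u} → definite body h xs hd u ∈ Γ →
                    ¬ Any (λ a → evalAtom L 𝒜 J v a ≡ false) body →
                    ∀ {e} → Image v h xs e → Hˢ e ≡ true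
        head-true {body} {h} {xs} {hd} C∈Γ body-true (w , v≼w , refl)
          with Any.++⁻ (map (λ a → neg (⌊_⌋ᵃ L a)) body)
                       (⌊Γ⌋-sat _ (inj₁ (_ , C∈Γ , refl)) (glue xs w v))
        ... | inj₁ body-false = ⊥-elim (body-true (false-atoms v _ body
                (λ y occ → below-glue xs C∈Γ v≼w y (inj₁ occ)) (Any.map⁻ body-false)))
        ... | inj₂ (here H-true) = subst (λ e → Hˢ e ≡ true)
                (feval-⌊⌋′-local h λ y occ → glue-∈ w v (head-occurs hd occ)) H-true

        J-sat : ∀ C → C ∈ Γ → satClause L 𝒜 J v C
        J-sat (goal as) C∈Γ = false-atoms v (glue [] w₀ v) as
          (λ y occ → below-glue [] C∈Γ (λ _ ()) y occ)
          (Any.map⁻ (⌊Γ⌋-sat _ (inj₁ (_ , C∈Γ , refl)) (glue [] w₀ v)))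
        J-sat (definite body h xs hd u) C∈Γ with em {Any (λ a → evalAtom L 𝒜 J v a ≡ false) body}
        ... | yes body-false = inj₁ body-false
        ... | no body-true with head-meet v hd u
        ...   | P , eval≡meet , P⊆image =
          inj₂ (trans eval≡meet (dec-true em λ _ pe → head-true C∈Γ body-true (P⊆image pe)))

  fo⇒standard : {𝔄 : Structure L → Set} → Compact L 𝔄 → (Γ : List (Clause L)) →
                FOSat L 𝔄 (⌊_⌋ᴳ L Γ) → Sat L 𝔄 (_∈ Γ)
  fo⇒standard compact Γ (𝒜 , 𝒜∈𝔄 , ℬ , ⌊Γ⌋-sat) =
    𝒜 , 𝒜∈𝔄 , J , λ C C∈Γ v → J-sat Γ ⌊Γ⌋-sat v C C∈Γ
    where open FO⇒Standard 𝒜 ℬ (dne⇒em (compact⇒dne compact 𝒜 𝒜∈𝔄))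

mainTheorem12 : (L : Lang) (𝔄 : Structure L → Set) → Compact L 𝔄 →
                (Γ : List (Clause L)) →
                Sat L 𝔄 (λ C → C ∈ Γ) ⇔ FOSat L 𝔄 (⌊_⌋ᴳ L Γ)
mainTheorem12 L 𝔄 compact Γ = mk⇔ (standard⇒fo L Γ) (fo⇒standard L compact Γ)
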